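{- Let $G$ be a graph with $n$ vertices and $m$ edges, and $S(G)$ its subdivision graph. Then $P_2M_1^5(S(G))=2mM_1^5+64m^2-M_1^6-4m-5M_1^5+10M_1^4-10M_1^3-26M_1^2$, where the invariants on the right are evaluated at $G$.
   Context: $S(G)$ is obtained from $G$ by inserting a new vertex on each edge. $M_1^\alpha(H)=\sum_{v}\deg_H(v)^\alpha$. For a graph invariant $f$ and a graph $H$, $P_2f(H)=\sum_{uv\in E(H)}f(H-\{u,v\})$, where $H-\{u,v\}$ is obtained by deleting the vertices $u,v$ and all edges incident to them. -}

module Defs where

open import Data.Nat using (ℕ; _+_; _^_; _<_)
open import Data.Fin using (Fin; toℕ; _↑ˡ_; _↑ʳ_)
open import Data.Fin using () renaming (_≟_ to _≟ᶠ_)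
open import Data.List using (List; length; map; filter; tabulate; lookup; concat; _∷_; [])
open import Data.Nat.ListAction using (sum)
open import Data.List.Relation.Unary.All using (All)
open import Data.List.Relation.Unary.AllPairs using (AllPairs)
open import Data.List.Relation.Unary.Unique.Propositional using (Unique)
open import Data.Product using (_×_; _,_; proj₁; proj₂)
open import Data.Sum using (_⊎_)
open import Relation.Nullary using (¬_)
open import Relation.Nullary.Decidable using (_⊎-dec_; _×-dec_; ¬?)
open import Relation.Binary.PropositionalEquality using (_≡_)

-- A (finite) graph: vertices are a sub-list of Fin V, edges are unordered pairs
-- stored as ordered pairs (each pair listed once).
record Graph : Set where
  field
    V     : ℕ
    verts : List (Fin V)
    edges : List (Fin V × Fin V)
open Graph public

record SimpleGraph (n : ℕ) : Set where
  field
    es       : List (Fin n × Fin n)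
    ordered  : All (λ e → toℕ (proj₁ e) < toℕ (proj₂ e)) es
    distinct : Unique es
open SimpleGraph public

toGraph : ∀ {n} → SimpleGraph n → Graph
toGraph {n} G = record { V = n ; verts = Data.List.allFin n ; edges = es G }

numEdges : ∀ {n} → SimpleGraph n → ℕ
numEdges G = length (es G)

deg : (H : Graph) → Fin (V H) → ℕ
deg H v = length (filter (λ e → (proj₁ e ≟ᶠ v) ⊎-dec (proj₂ e ≟ᶠ v)) (edges H))

M1 : ℕ → Graph → ℕ
M1 α H = sum (map (λ v → deg H v ^ α) (verts H))

delete : (H : Graph) → Fin (V H) → Fin (V H) → Graph
delete H u v = record
  { V = V H
  ; verts = filter (λ w → ¬? (w ≟ᶠ u) ×-dec ¬? (w ≟ᶠ v)) (verts H)
  ; edges = filter (λ e → (¬? (proj₁ e ≟ᶠ u) ×-dec ¬? (proj₁ e ≟ᶠ v))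
                      ×-dec (¬? (proj₂ e ≟ᶠ u) ×-dec ¬? (proj₂ e ≟ᶠ v))) (edges H)
  }

P2 : (Graph → ℕ) → Graph → ℕ
P2 f H = sum (map (λ e → f (delete H (proj₁ e) (proj₂ e))) (edges H))

-- Subdivision S(G): vertices Fin (n + m); original vertex a ↦ a ↑ˡ m,
-- k-th edge (a , b) ↦ new vertex n ↑ʳ k, adjacent to a and b.
subdivision : ∀ {n} → SimpleGraph n → Graph
subdivision {n} G = record
  { V = n + m
  ; verts = Data.List.allFin (n + m)
  ; edges = concat (tabulate (λ (k : Fin m) →
      let e = lookup (es G) k in
      (proj₁ e ↑ˡ m , n ↑ʳ k) ∷ (proj₂ e ↑ˡ m , n ↑ʳ k) ∷ []))
  }
  where m = length (es G)

-- Every edge of S(G) joins a vertex p of G to the subdivision vertex w_k of an edge k = pq of G.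
-- Deleting p and w_k leaves the other vertices of G with their degrees except q, which loses one,
-- and the other subdivision vertices with degree 2 except the d_p - 1 on the remaining edges at p,
-- which drop to 1. Hence
--   M₁^α(S(G) - {p, w_k}) = M_α - d_p^α - d_q^α + (d_q - 1)^α + 2^α (m - d_p) + d_p - 1,
-- and summing over the 2m pairs (p, k) with the handshake identity Σ_k (f(a_k) + f(b_k)) = Σ_v d_v f(v),
-- where a_k and b_k are the ends of k, turns P₂M₁^α(S(G)) into sums Σ_v d_v g(d_v). For α = 5,
-- expanding d (d - 1)⁵ binomially expresses them through the M₁^j(G).
module Submission where

open import Defs
open import Data.Nat using (ℕ)
open import Relation.Binary.PropositionalEquality using (_≡_)

open import Data.Bool using (Bool; true; false; _∧_; _∨_; not)
open import Data.Fin using (Fin; zero; suc; _↑ˡ_; _↑ʳ_) renaming (_≟_ to _≟ᶠ_)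
open import Data.List using (List; []; _∷_; length; map; filter; tabulate; concat)
open import Relation.Binary.PropositionalEquality using (_≢_; ≢-sym; refl; sym; trans; cong; cong₂; module ≡-Reasoning)
open import Relation.Nullary using (does; contradiction)
open import Data.Empty using (⊥; ⊥-elim)
open import Relation.Nullary.Decidable using (dec-true; dec-false; does-⇔)
open import Function.Bundles using (mk⇔)
open import Relation.Unary using (Decidable)

module Counting where
  open import Data.Nat using (zero; suc; _+_; _*_)
  open import Data.Nat.Properties using (+-*-semiring; *-zeroʳ; *-identityˡ; *-identityʳ; +-identityʳ; +-assoc; *-distribʳ-+)
  open import Data.Nat.ListAction using (sum)
  open import Relation.Nullary using (yes; no)
  open import Algebra.Properties.Semiring.Sum +-*-semiring public
    using (sum-syntax; ∑-distrib-+; ∑-comm; sum-cong-≗; *-distribˡ-sum; *-distribʳ-sum)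

  ⟦_⟧ : Bool → ℕ
  ⟦ true ⟧  = 1
  ⟦ false ⟧ = 0

  δ : ∀ {k} → Fin k → Fin k → ℕ
  δ i j = ⟦ does (i ≟ᶠ j) ⟧

  δ-refl : ∀ {k} (i : Fin k) → δ i i ≡ 1
  δ-refl i = cong ⟦_⟧ (dec-true (i ≟ᶠ i) refl)

  δ-≢ : ∀ {k} {i j : Fin k} → i ≢ j → δ i j ≡ 0
  δ-≢ {i = i} {j} i≢j = cong ⟦_⟧ (dec-false (i ≟ᶠ j) i≢j)

  δ-sym : ∀ {k} (i j : Fin k) → δ i j ≡ δ j i
  δ-sym i j = cong ⟦_⟧ (does-⇔ (mk⇔ sym sym) (i ≟ᶠ j) (j ≟ᶠ i))

  ≟-true⇒≡ : ∀ {k} {i j : Fin k} → does (i ≟ᶠ j) ≡ true → i ≡ j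
  ≟-true⇒≡ {i = i} {j} does≡true with i ≟ᶠ j
  ... | yes i≡j = i≡j
  ... | no _    with () ← does≡true

  ⟦∧⟧ : ∀ x y → ⟦ x ∧ y ⟧ ≡ ⟦ x ⟧ * ⟦ y ⟧
  ⟦∧⟧ true  true  = refl
  ⟦∧⟧ true  false = refl
  ⟦∧⟧ false y     = refl

  ⟦not⟧+⟦⟧ : ∀ x → ⟦ not x ⟧ + ⟦ x ⟧ ≡ 1
  ⟦not⟧+⟦⟧ true  = refl
  ⟦not⟧+⟦⟧ false = refl

  ∑-const : ∀ n c → ∑[ i < n ] c ≡ n * c
  ∑-const zero    c = refl
  ∑-const (suc n) c = cong (c +_) (∑-const n c)

  ∑-δ : ∀ {n} (k : Fin n) (f : Fin n → ℕ) → ∑[ i < n ] (δ i k * f i) ≡ f k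
  ∑-δ {suc n} zero f = begin
    f zero + 0 + ∑[ i < n ] 0  ≡⟨ cong (f zero + 0 +_) (trans (∑-const n 0) (*-zeroʳ n)) ⟩
    f zero + 0 + 0             ≡⟨ trans (+-identityʳ _) (+-identityʳ _) ⟩
    f zero                     ∎
    where open ≡-Reasoning
  ∑-δ {suc n} (suc k) f = ∑-δ k (λ i → f (suc i))

  ∑-δ-one : ∀ {n} (k : Fin n) → ∑[ i < n ] δ i k ≡ 1
  ∑-δ-one {n} k = trans (sum-cong-≗ (λ i → sym (*-identityʳ (δ i k)))) (∑-δ k (λ _ → 1))

  ∑-δ-complement : ∀ {n} (k : Fin n) (f : Fin n → ℕ) →
                   ∑[ i < n ] (⟦ not (does (i ≟ᶠ k)) ⟧ * f i) + f k ≡ ∑[ i < n ] f i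
  ∑-δ-complement {n} k f = begin
    ∑[ i < n ] (⟦ not (does (i ≟ᶠ k)) ⟧ * f i) + f k
      ≡⟨ cong (∑[ i < n ] (⟦ not (does (i ≟ᶠ k)) ⟧ * f i) +_) (sym (∑-δ k f)) ⟩
    ∑[ i < n ] (⟦ not (does (i ≟ᶠ k)) ⟧ * f i) + ∑[ i < n ] (δ i k * f i)
      ≡⟨ sym (∑-distrib-+ (λ i → ⟦ not (does (i ≟ᶠ k)) ⟧ * f i) (λ i → δ i k * f i)) ⟩
    ∑[ i < n ] (⟦ not (does (i ≟ᶠ k)) ⟧ * f i + δ i k * f i)
      ≡⟨ sum-cong-≗ (λ i → trans (sym (*-distribʳ-+ (f i) ⟦ not (does (i ≟ᶠ k)) ⟧ (δ i k)))
                                  (cong (_* f i) (⟦not⟧+⟦⟧ (does (i ≟ᶠ k))))) ⟩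
    ∑[ i < n ] (1 * f i)
      ≡⟨ sum-cong-≗ (λ i → *-identityˡ (f i)) ⟩
    ∑[ i < n ] f i ∎
    where open ≡-Reasoning

  ∑-linear : ∀ {n} c (f g : Fin n → ℕ) → ∑[ i < n ] (f i + c * g i) ≡ ∑[ i < n ] f i + c * ∑[ i < n ] g i
  ∑-linear c f g = trans (∑-distrib-+ f (λ i → c * g i)) (cong (∑[ i < _ ] f i +_) (sym (*-distribˡ-sum c g)))

  ∑-↑ : ∀ a {b} (f : Fin (a + b) → ℕ) →
        ∑[ i < a + b ] f i ≡ ∑[ i < a ] f (i ↑ˡ b) + ∑[ j < b ] f (a ↑ʳ j)
  ∑-↑ zero    f = refl
  ∑-↑ (suc a) f = trans (cong (f zero +_) (∑-↑ a (λ i → f (suc i)))) (sym (+-assoc (f zero) _ _))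

  sum-map-tabulate : ∀ {A : Set} {k} (f : A → ℕ) (g : Fin k → A) →
                     sum (map f (tabulate g)) ≡ ∑[ i < k ] f (g i)
  sum-map-tabulate {k = zero}  f g = refl
  sum-map-tabulate {k = suc k} f g = cong (f (g zero) +_) (sum-map-tabulate f (λ i → g (suc i)))

  sum-map-concat-pairs : ∀ {A : Set} {k} (f : A → ℕ) (u w : Fin k → A) →
    sum (map f (concat (tabulate (λ i → u i ∷ w i ∷ [])))) ≡ ∑[ i < k ] (f (u i) + f (w i))
  sum-map-concat-pairs {k = zero}  f u w = refl
  sum-map-concat-pairs {k = suc k} f u w =
    trans (sym (+-assoc (f (u zero)) (f (w zero)) _))
          (cong (f (u zero) + f (w zero) +_) (sum-map-concat-pairs f (λ i → u (suc i)) (λ i → w (suc i))))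

  sum-map-filter : ∀ {A : Set} {P : A → Set} (P? : Decidable P) (g : A → ℕ) (xs : List A) →
                   (∀ x → does (P? x) ≡ false → g x ≡ 0) → sum (map g (filter P? xs)) ≡ sum (map g xs)
  sum-map-filter P? g []       g-vanishes = refl
  sum-map-filter P? g (x ∷ xs) g-vanishes with does (P? x) in eq
  ... | true  = cong (g x +_) (sum-map-filter P? g xs g-vanishes)
  ... | false = cong₂ _+_ (sym (g-vanishes x eq)) (sum-map-filter P? g xs g-vanishes)

  length-filter : ∀ {A : Set} {P : A → Set} (P? : Decidable P) (xs : List A) →
                  length (filter P? xs) ≡ sum (map (λ x → ⟦ does (P? x) ⟧) xs)
  length-filter P? []       = refl
  length-filter P? (x ∷ xs) with does (P? x)
  ... | true  = cong suc (length-filter P? xs)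
  ... | false = length-filter P? xs

  length-filter-filter : ∀ {A : Set} {P Q : A → Set} (P? : Decidable P) (Q? : Decidable Q) (xs : List A) →
    length (filter Q? (filter P? xs)) ≡ sum (map (λ x → ⟦ does (P? x) ∧ does (Q? x) ⟧) xs)
  length-filter-filter P? Q? []       = refl
  length-filter-filter P? Q? (x ∷ xs) with does (P? x)
  ... | false = length-filter-filter P? Q? xs
  ... | true  with does (Q? x)
  ...   | true  = cong suc (length-filter-filter P? Q? xs)
  ...   | false = length-filter-filter P? Q? xs

open Counting

module Degrees (H : Graph) where
  open import Data.Nat using (suc; _^_)
  open import Data.Nat.ListAction using (sum)
  open import Data.Product using (_×_; _,_; proj₁; proj₂)
  open import Data.Sum using (_⊎_; inj₁; inj₂)
  open import Relation.Nullary using (¬_; yes; no; ¬?; _×-dec_; _⊎-dec_)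
  open import Data.List.Properties using (filter-none)
  import Data.List.Relation.Unary.All as All
  open import Data.List.Relation.Unary.All.Properties using (all-filter)

  Edge : Set
  Edge = Fin (V H) × Fin (V H)

  IncidentTo : Fin (V H) → Edge → Set
  IncidentTo w e = proj₁ e ≡ w ⊎ proj₂ e ≡ w

  incident? : ∀ w → Decidable (IncidentTo w)
  incident? w e = (proj₁ e ≟ᶠ w) ⊎-dec (proj₂ e ≟ᶠ w)

  Avoids : Fin (V H) → Fin (V H) → Edge → Set
  Avoids x y e = (proj₁ e ≢ x × proj₁ e ≢ y) × (proj₂ e ≢ x × proj₂ e ≢ y)

  avoids? : ∀ x y → Decidable (Avoids x y)
  avoids? x y e = (¬? (proj₁ e ≟ᶠ x) ×-dec ¬? (proj₁ e ≟ᶠ y))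
            ×-dec (¬? (proj₂ e ≟ᶠ x) ×-dec ¬? (proj₂ e ≟ᶠ y))

  deg-≡-sum : ∀ w → deg H w ≡ sum (map (λ e → ⟦ does (incident? w e) ⟧) (edges H))
  deg-≡-sum w = length-filter (incident? w) (edges H)

  deg-delete-≡-sum : ∀ x y w →
    deg (delete H x y) w ≡ sum (map (λ e → ⟦ does (avoids? x y e) ∧ does (incident? w e) ⟧) (edges H))
  deg-delete-≡-sum x y w = length-filter-filter (avoids? x y) (incident? w) (edges H)

  deg-delete-fst : ∀ x y → deg (delete H x y) x ≡ 0
  deg-delete-fst x y = cong length (filter-none (incident? x) (All.map avoids-x (all-filter (avoids? x y) (edges H))))
    where
    avoids-x : ∀ {e} → Avoids x y e → ¬ IncidentTo x e
    avoids-x ((e₁≢x , _) , _) (inj₁ e₁≡x) = e₁≢x e₁≡x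
    avoids-x (_ , (e₂≢x , _)) (inj₂ e₂≡x) = e₂≢x e₂≡x

  deg-delete-snd : ∀ x y → deg (delete H x y) y ≡ 0
  deg-delete-snd x y = cong length (filter-none (incident? y) (All.map avoids-y (all-filter (avoids? x y) (edges H))))
    where
    avoids-y : ∀ {e} → Avoids x y e → ¬ IncidentTo y e
    avoids-y ((_ , e₁≢y) , _) (inj₁ e₁≡y) = e₁≢y e₁≡y
    avoids-y (_ , (_ , e₂≢y)) (inj₂ e₂≡y) = e₂≢y e₂≡y

  M1-delete : ∀ α x y →
    M1 (suc α) (delete H x y) ≡ sum (map (λ w → deg (delete H x y) w ^ suc α) (verts H))
  M1-delete α x y = sum-map-filter _ _ (verts H) deleted-vanish
    where
    deleted-vanish : ∀ w → does (¬? (w ≟ᶠ x) ×-dec ¬? (w ≟ᶠ y)) ≡ false → deg (delete H x y) w ^ suc α ≡ 0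
    deleted-vanish w kept? with w ≟ᶠ x | w ≟ᶠ y
    ... | yes refl | _        = cong (_^ suc α) (deg-delete-fst x y)
    ... | no _     | yes refl = cong (_^ suc α) (deg-delete-snd x y)
    ... | no _     | no _     with () ← kept?

module _ where
  open import Data.Nat using (zero; suc; _+_; _*_; _^_; _∸_)
  open import Data.Nat.Solver using (module +-*-Solver)
  open +-*-Solver

  binomial-identity : ∀ x → x * ((x ∸ 1) ^ 5 + x) + (x ^ 6 + 2 * x + 5 * x ^ 5 + 10 * x ^ 3 + 26 * x ^ 2)
                      ≡ x * (2 * x ^ 5 + 1 + 32 * x) + 10 * x ^ 4
  binomial-identity zero    = refl
  binomial-identity (suc y) = solve 1 (λ y → let x = con 1 :+ y in
    x :* (y :^ 5 :+ x) :+ (x :^ 6 :+ con 2 :* x :+ con 5 :* x :^ 5 :+ con 10 :* x :^ 3 :+ con 26 :* x :^ 2)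
      := x :* (con 2 :* x :^ 5 :+ con 1 :+ con 32 :* x) :+ con 10 :* x :^ 4) refl y

module Subdivision {n : ℕ} (G : SimpleGraph n) where
  open import Data.Nat using (suc; _+_; _*_; _^_; _∸_)
  open import Data.Nat.Properties
    using ( <-irrefl; m+n∸n≡m; ^-zeroˡ; +-comm; +-assoc; +-cancelʳ-≡; +-identityʳ
          ; *-assoc; *-comm; *-identityʳ; *-zeroʳ; *-distribʳ-+; *-distribˡ-+)
  open import Data.Nat.ListAction using (sum)
  open import Data.Bool.Properties using (∧-identityʳ; ∧-zeroʳ; ∨-identityʳ)
  open import Data.Product using (_×_; _,_; proj₁; proj₂)
  open import Data.Sum using (_⊎_; inj₁; inj₂)
  open import Data.Fin using (toℕ; splitAt)
  open import Data.Fin.Properties using (↑ˡ-injective; ↑ʳ-injective; splitAt-↑ˡ; splitAt-↑ʳ)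
  open import Data.List using (lookup; allFin)
  open import Data.List.Properties using (tabulate-lookup)
  import Data.List.Relation.Unary.All as All
  open import Data.List.Membership.Propositional.Properties using (∈-lookup)
  open import Relation.Nullary using (yes; no)
  open ≡-Reasoning
  open import Data.Nat.Tactic.RingSolver using (solve-∀)

  m : ℕ
  m = numEdges G

  a b : Fin m → Fin n
  a k = proj₁ (lookup (es G) k)
  b k = proj₂ (lookup (es G) k)

  d : Fin n → ℕ
  d = deg (toGraph G)

  module DG = Degrees (toGraph G)

  a≢b : ∀ k → a k ≢ b k
  a≢b k eq = <-irrefl (cong toℕ eq) (All.lookup (ordered G) (∈-lookup k))

  deg-≡-∑ : ∀ v → d v ≡ ∑[ k < m ] (δ (a k) v + δ (b k) v)
  deg-≡-∑ v = begin
    d v                                        ≡⟨ DG.deg-≡-sum v ⟩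
    sum (map incidence (es G))                 ≡⟨ cong (λ es → sum (map incidence es)) (sym (tabulate-lookup (es G))) ⟩
    sum (map incidence (tabulate (lookup (es G)))) ≡⟨ sum-map-tabulate incidence (lookup (es G)) ⟩
    ∑[ k < m ] ⟦ does (a k ≟ᶠ v) ∨ does (b k ≟ᶠ v) ⟧ ≡⟨ sum-cong-≗ incidence-split ⟩
    ∑[ k < m ] (δ (a k) v + δ (b k) v)         ∎
    where
    incidence : Fin n × Fin n → ℕ
    incidence e = ⟦ does (DG.incident? v e) ⟧
    incidence-split : ∀ k → ⟦ does (a k ≟ᶠ v) ∨ does (b k ≟ᶠ v) ⟧ ≡ δ (a k) v + δ (b k) v
    incidence-split k with a k ≟ᶠ v | b k ≟ᶠ v
    ... | yes refl | yes bₖ≡v = contradiction (sym bₖ≡v) (a≢b k)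
    ... | yes _    | no _     = refl
    ... | no _     | _        = refl

  handshake : ∀ (f : Fin n → ℕ) → ∑[ k < m ] (f (a k) + f (b k)) ≡ ∑[ v < n ] (d v * f v)
  handshake f = sym (begin
    ∑[ v < n ] (d v * f v)
      ≡⟨ sum-cong-≗ (λ v → trans (cong (_* f v) (deg-≡-∑ v)) (*-distribʳ-sum (f v) (λ k → δ (a k) v + δ (b k) v))) ⟩
    ∑[ v < n ] ∑[ k < m ] ((δ (a k) v + δ (b k) v) * f v)
      ≡⟨ ∑-comm (λ v k → (δ (a k) v + δ (b k) v) * f v) ⟩
    ∑[ k < m ] ∑[ v < n ] ((δ (a k) v + δ (b k) v) * f v)
      ≡⟨ sum-cong-≗ (λ k → sum-cong-≗ (λ v → split k v)) ⟩
    ∑[ k < m ] ∑[ v < n ] (δ v (a k) * f v + δ v (b k) * f v)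
      ≡⟨ sum-cong-≗ (λ k → trans (∑-distrib-+ (λ v → δ v (a k) * f v) (λ v → δ v (b k) * f v))
                                  (cong₂ _+_ (∑-δ (a k) f) (∑-δ (b k) f))) ⟩
    ∑[ k < m ] (f (a k) + f (b k)) ∎)
    where
    split : ∀ k v → (δ (a k) v + δ (b k) v) * f v ≡ δ v (a k) * f v + δ v (b k) * f v
    split k v = trans (*-distribʳ-+ (f v) (δ (a k) v) _)
                      (cong₂ (λ x y → x * f v + y * f v) (δ-sym (a k) v) (δ-sym (b k) v))

  S : Graph
  S = subdivision G

  module DS = Degrees S

  orig : Fin n → Fin (n + m)
  orig v = v ↑ˡ m

  mid : Fin m → Fin (n + m)
  mid k = n ↑ʳ k

  orig≢mid : ∀ c j → orig c ≢ mid j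
  orig≢mid c j eq with () ← trans (sym (splitAt-↑ˡ n c m)) (trans (cong (splitAt n) eq) (splitAt-↑ʳ n m j))

  ≟-orig : ∀ c v → does (orig c ≟ᶠ orig v) ≡ does (c ≟ᶠ v)
  ≟-orig c v = does-⇔ (mk⇔ (↑ˡ-injective m c v) (cong orig)) (orig c ≟ᶠ orig v) (c ≟ᶠ v)

  ≟-mid : ∀ j k → does (mid j ≟ᶠ mid k) ≡ does (j ≟ᶠ k)
  ≟-mid j k = does-⇔ (mk⇔ (↑ʳ-injective n j k) (cong mid)) (mid j ≟ᶠ mid k) (j ≟ᶠ k)

  ≟-orig-mid : ∀ c j → does (orig c ≟ᶠ mid j) ≡ false
  ≟-orig-mid c j = dec-false (orig c ≟ᶠ mid j) (orig≢mid c j)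

  ≟-mid-orig : ∀ j c → does (mid j ≟ᶠ orig c) ≡ false
  ≟-mid-orig j c = dec-false (mid j ≟ᶠ orig c) (λ eq → orig≢mid c j (sym eq))

  ∑-over-S-edges : (Fin n → Fin m → ℕ) → ℕ
  ∑-over-S-edges t = ∑[ j < m ] (t (a j) j + t (b j) j)

  ∑-over-S-edges-cong : ∀ {s t : Fin n → Fin m → ℕ} → (∀ c j → s c j ≡ t c j) → ∑-over-S-edges s ≡ ∑-over-S-edges t
  ∑-over-S-edges-cong s≡t = sum-cong-≗ (λ j → cong₂ _+_ (s≡t (a j) j) (s≡t (b j) j))

  sum-map-edges-S : ∀ (f : DS.Edge → ℕ) → sum (map f (edges S)) ≡ ∑-over-S-edges (λ c j → f (orig c , mid j))
  sum-map-edges-S f = sum-map-concat-pairs f (λ j → orig (a j) , mid j) (λ j → orig (b j) , mid j)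

  S∖ : Fin n → Fin m → Graph
  S∖ p k = delete S (orig p) (mid k)

  survives : Fin n → Fin m → Fin n → Fin m → Bool
  survives p k c j = not (does (c ≟ᶠ p)) ∧ not (does (j ≟ᶠ k))

  avoids-S : ∀ p k c j → does (DS.avoids? (orig p) (mid k) (orig c , mid j)) ≡ survives p k c j
  avoids-S p k c j rewrite ≟-orig c p | ≟-orig-mid c k | ≟-mid-orig j p | ≟-mid j k =
    cong (_∧ not (does (j ≟ᶠ k))) (∧-identityʳ _)

  incident-orig : ∀ v c j → does (DS.incident? (orig v) (orig c , mid j)) ≡ does (c ≟ᶠ v)
  incident-orig v c j rewrite ≟-orig c v | ≟-mid-orig j v = ∨-identityʳ _

  incident-mid : ∀ i c j → does (DS.incident? (mid i) (orig c , mid j)) ≡ does (j ≟ᶠ i)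
  incident-mid i c j rewrite ≟-orig-mid c i | ≟-mid j i = refl

  deg-S∖-≡-∑ : ∀ p k w →
    deg (S∖ p k) w ≡ ∑-over-S-edges (λ c j → ⟦ survives p k c j ∧ does (DS.incident? w (orig c , mid j)) ⟧)
  deg-S∖-≡-∑ p k w = begin
    deg (S∖ p k) w
      ≡⟨ DS.deg-delete-≡-sum (orig p) (mid k) w ⟩
    sum (map (λ e → ⟦ does (DS.avoids? (orig p) (mid k) e) ∧ incident e ⟧) (edges S))
      ≡⟨ sum-map-edges-S _ ⟩
    ∑-over-S-edges (λ c j → ⟦ does (DS.avoids? (orig p) (mid k) (orig c , mid j)) ∧ incident (orig c , mid j) ⟧)
      ≡⟨ ∑-over-S-edges-cong (λ c j → cong (λ s → ⟦ s ∧ incident (orig c , mid j) ⟧) (avoids-S p k c j)) ⟩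
    ∑-over-S-edges (λ c j → ⟦ survives p k c j ∧ incident (orig c , mid j) ⟧) ∎
    where
    incident : DS.Edge → Bool
    incident e = does (DS.incident? w e)

  Joins : Fin m → Fin n → Fin n → Set
  Joins k p q = (a k ≡ p × b k ≡ q) ⊎ (a k ≡ q × b k ≡ p)

  joins-≢ : ∀ {k p q} → Joins k p q → p ≢ q
  joins-≢ {k} (inj₁ (refl , refl)) = a≢b k
  joins-≢ {k} (inj₂ (refl , refl)) = λ bₖ≡aₖ → a≢b k (sym bₖ≡aₖ)

  joins-δ : ∀ {k p q} → Joins k p q → ∀ v → δ (a k) v + δ (b k) v ≡ δ p v + δ q v
  joins-δ (inj₁ (refl , refl)) v = refl
  joins-δ {k} (inj₂ (refl , refl)) v = +-comm (δ (a k) v) (δ (b k) v)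

  deg-S∖-orig : ∀ {k p q v} → Joins k p q → v ≢ p → deg (S∖ p k) (orig v) + δ q v ≡ d v
  deg-S∖-orig {k} {p} {q} {v} J v≢p = begin
    deg (S∖ p k) (orig v) + δ q v
      ≡⟨ cong (deg (S∖ p k) (orig v) +_) (sym (trans (joins-δ J v) (cong (_+ δ q v) (δ-≢ (≢-sym v≢p))))) ⟩
    deg (S∖ p k) (orig v) + incidences k
      ≡⟨ cong (_+ incidences k) (trans (deg-S∖-≡-∑ p k (orig v)) (∑-over-S-edges-cong term)) ⟩
    ∑[ j < m ] (⟦ not (does (j ≟ᶠ k)) ⟧ * δ (a j) v + ⟦ not (does (j ≟ᶠ k)) ⟧ * δ (b j) v) + incidences k
      ≡⟨ cong (_+ incidences k) (sum-cong-≗ (λ j → sym (*-distribˡ-+ ⟦ not (does (j ≟ᶠ k)) ⟧ (δ (a j) v) _))) ⟩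
    ∑[ j < m ] (⟦ not (does (j ≟ᶠ k)) ⟧ * incidences j) + incidences k
      ≡⟨ ∑-δ-complement k incidences ⟩
    ∑[ j < m ] incidences j
      ≡⟨ sym (deg-≡-∑ v) ⟩
    d v ∎
    where
    incidences : Fin m → ℕ
    incidences j = δ (a j) v + δ (b j) v
    term : ∀ c j → ⟦ survives p k c j ∧ does (DS.incident? (orig v) (orig c , mid j)) ⟧
                 ≡ ⟦ not (does (j ≟ᶠ k)) ⟧ * δ c v
    term c j rewrite incident-orig v c j with c ≟ᶠ v
    ... | no _     = trans (cong ⟦_⟧ (∧-zeroʳ (survives p k c j))) (sym (*-zeroʳ ⟦ not (does (j ≟ᶠ k)) ⟧))
    ... | yes refl = begin
      ⟦ survives p k c j ∧ true ⟧                   ≡⟨ cong ⟦_⟧ (∧-identityʳ (survives p k c j)) ⟩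
      ⟦ not (does (c ≟ᶠ p)) ∧ not (does (j ≟ᶠ k)) ⟧ ≡⟨ cong (λ s → ⟦ not s ∧ _ ⟧) (dec-false (c ≟ᶠ p) v≢p) ⟩
      ⟦ not (does (j ≟ᶠ k)) ⟧                       ≡⟨ sym (*-identityʳ _) ⟩
      ⟦ not (does (j ≟ᶠ k)) ⟧ * 1                   ∎

  deg-S∖-mid : ∀ p k i → deg (S∖ p k) (mid i) ≡ ⟦ survives p k (a i) i ⟧ + ⟦ survives p k (b i) i ⟧
  deg-S∖-mid p k i = begin
    deg (S∖ p k) (mid i)
      ≡⟨ trans (deg-S∖-≡-∑ p k (mid i)) (∑-over-S-edges-cong term) ⟩
    ∑[ j < m ] (δ j i * ⟦ survives p k (a j) j ⟧ + δ j i * ⟦ survives p k (b j) j ⟧)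
      ≡⟨ sum-cong-≗ (λ j → sym (*-distribˡ-+ (δ j i) ⟦ survives p k (a j) j ⟧ _)) ⟩
    ∑[ j < m ] (δ j i * (⟦ survives p k (a j) j ⟧ + ⟦ survives p k (b j) j ⟧))
      ≡⟨ ∑-δ i (λ j → ⟦ survives p k (a j) j ⟧ + ⟦ survives p k (b j) j ⟧) ⟩
    ⟦ survives p k (a i) i ⟧ + ⟦ survives p k (b i) i ⟧ ∎
    where
    term : ∀ c j → ⟦ survives p k c j ∧ does (DS.incident? (mid i) (orig c , mid j)) ⟧
                 ≡ δ j i * ⟦ survives p k c j ⟧
    term c j = begin
      ⟦ survives p k c j ∧ does (DS.incident? (mid i) (orig c , mid j)) ⟧
        ≡⟨ cong (λ s → ⟦ survives p k c j ∧ s ⟧) (incident-mid i c j) ⟩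
      ⟦ survives p k c j ∧ does (j ≟ᶠ i) ⟧
        ≡⟨ ⟦∧⟧ (survives p k c j) (does (j ≟ᶠ i)) ⟩
      ⟦ survives p k c j ⟧ * δ j i
        ≡⟨ *-comm ⟦ survives p k c j ⟧ (δ j i) ⟩
      δ j i * ⟦ survives p k c j ⟧ ∎

  deg-S∖-other-end : ∀ {k p q} → Joins k p q → deg (S∖ p k) (orig q) ≡ d q ∸ 1
  deg-S∖-other-end {k} {p} {q} J = begin
    deg (S∖ p k) (orig q)               ≡⟨ sym (m+n∸n≡m _ 1) ⟩
    deg (S∖ p k) (orig q) + 1 ∸ 1       ≡⟨ cong (λ x → deg (S∖ p k) (orig q) + x ∸ 1) (sym (δ-refl q)) ⟩
    deg (S∖ p k) (orig q) + δ q q ∸ 1   ≡⟨ cong (_∸ 1) (deg-S∖-orig J (≢-sym (joins-≢ J))) ⟩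
    d q ∸ 1                             ∎

  deg-S∖-far : ∀ {k p q v} → Joins k p q → v ≢ p → v ≢ q → deg (S∖ p k) (orig v) ≡ d v
  deg-S∖-far {k} {p} {q} {v} J v≢p v≢q = begin
    deg (S∖ p k) (orig v)           ≡⟨ sym (+-identityʳ _) ⟩
    deg (S∖ p k) (orig v) + 0       ≡⟨ cong (deg (S∖ p k) (orig v) +_) (sym (δ-≢ (≢-sym v≢q))) ⟩
    deg (S∖ p k) (orig v) + δ q v   ≡⟨ deg-S∖-orig J v≢p ⟩
    d v                             ∎

  orig-power : ∀ α {k p q} → Joins k p q → ∀ v →
    deg (S∖ p k) (orig v) ^ suc α + δ v p * d p ^ suc α + δ v q * d q ^ suc α
      ≡ d v ^ suc α + δ v q * (d q ∸ 1) ^ suc α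
  orig-power α {k} {p} {q} J v with v ≟ᶠ p
  ... | yes refl rewrite DS.deg-delete-fst (orig v) (mid k) | δ-≢ (joins-≢ J) = +-identityʳ _
  ... | no v≢p with v ≟ᶠ q
  ...   | yes refl rewrite deg-S∖-other-end J =
    trans (cong ((d v ∸ 1) ^ suc α + 0 +_) (+-identityʳ (d v ^ suc α))) (+-comm ((d v ∸ 1) ^ suc α + 0) (d v ^ suc α))
  ...   | no v≢q   rewrite deg-S∖-far J v≢p v≢q = +-identityʳ _

  -- A and B say whether p is an end of the edge j, Z whether j = k: the degree of w_j in
  -- S(G) - {p, w_k} is 0 if j = k, 1 if p is an end of j ≠ k, and 2 otherwise.
  subdivision-vertex-power : ∀ α (A B Z : Bool) →
    (A ≡ true → B ≡ true → ⊥) → (Z ≡ true → ⟦ A ⟧ + ⟦ B ⟧ ≡ 1) →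
    (⟦ not A ∧ not Z ⟧ + ⟦ not B ∧ not Z ⟧) ^ suc α + ⟦ Z ⟧ + 2 ^ suc α * (⟦ A ⟧ + ⟦ B ⟧)
      ≡ 2 ^ suc α + (⟦ A ⟧ + ⟦ B ⟧)
  subdivision-vertex-power α true  true  Z     not-both _ = ⊥-elim (not-both refl refl)
  subdivision-vertex-power α false false true  _ one-end with () ← one-end refl
  subdivision-vertex-power α true  false true  _ _ rewrite *-identityʳ (2 ^ suc α) = +-comm 1 (2 ^ suc α)
  subdivision-vertex-power α false true  true  _ _ rewrite *-identityʳ (2 ^ suc α) = +-comm 1 (2 ^ suc α)
  subdivision-vertex-power α true  false false _ _ rewrite ^-zeroˡ (suc α) | *-identityʳ (2 ^ suc α) = +-comm 1 (2 ^ suc α)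
  subdivision-vertex-power α false true  false _ _ rewrite ^-zeroˡ (suc α) | *-identityʳ (2 ^ suc α) = +-comm 1 (2 ^ suc α)
  subdivision-vertex-power α false false false _ _ =
    trans (cong (2 ^ suc α + 0 +_) (*-zeroʳ (2 ^ suc α))) (+-identityʳ _)

  mid-power : ∀ α {k p q} → Joins k p q → ∀ j →
    deg (S∖ p k) (mid j) ^ suc α + δ j k + 2 ^ suc α * (δ (a j) p + δ (b j) p)
      ≡ 2 ^ suc α + (δ (a j) p + δ (b j) p)
  mid-power α {k} {p} {q} J j rewrite deg-S∖-mid p k j =
    subdivision-vertex-power α (does (a j ≟ᶠ p)) (does (b j ≟ᶠ p)) (does (j ≟ᶠ k)) not-both endpoint
    where
    not-both : does (a j ≟ᶠ p) ≡ true → does (b j ≟ᶠ p) ≡ true → ⊥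
    not-both aⱼ≡p bⱼ≡p = a≢b j (trans (≟-true⇒≡ aⱼ≡p) (sym (≟-true⇒≡ bⱼ≡p)))
    endpoint : does (j ≟ᶠ k) ≡ true → δ (a j) p + δ (b j) p ≡ 1
    endpoint j≡k with refl ← ≟-true⇒≡ {i = j} {k} j≡k =
      trans (joins-δ J p) (cong₂ _+_ (δ-refl p) (δ-≢ (≢-sym (joins-≢ J))))

  moment : ℕ → ℕ
  moment α = ∑[ v < n ] (d v ^ α)

  M1-S∖-split : ∀ α p k →
    M1 (suc α) (S∖ p k) ≡ ∑[ v < n ] (deg (S∖ p k) (orig v) ^ suc α) + ∑[ j < m ] (deg (S∖ p k) (mid j) ^ suc α)
  M1-S∖-split α p k = begin
    M1 (suc α) (S∖ p k)                             ≡⟨ DS.M1-delete α (orig p) (mid k) ⟩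
    sum (map D (allFin (n + m)))                    ≡⟨ sum-map-tabulate D (λ w → w) ⟩
    ∑[ w < n + m ] D w                              ≡⟨ ∑-↑ n D ⟩
    ∑[ v < n ] (deg (S∖ p k) (orig v) ^ suc α) + ∑[ j < m ] (deg (S∖ p k) (mid j) ^ suc α) ∎
    where
    D : Fin (n + m) → ℕ
    D w = deg (S∖ p k) w ^ suc α

  ∑-orig-power : ∀ α {k p q} → Joins k p q →
    ∑[ v < n ] (deg (S∖ p k) (orig v) ^ suc α) + d p ^ suc α + d q ^ suc α ≡ moment (suc α) + (d q ∸ 1) ^ suc α
  ∑-orig-power α {k} {p} {q} J = begin
    ∑[ v < n ] D v + d p ^ suc α + d q ^ suc α
      ≡⟨ cong₂ _+_ (cong (∑[ v < n ] D v +_) (sym (∑-δ p (λ _ → d p ^ suc α)))) (sym (∑-δ q (λ _ → d q ^ suc α))) ⟩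
    ∑[ v < n ] D v + ∑[ v < n ] (δ v p * d p ^ suc α) + ∑[ v < n ] (δ v q * d q ^ suc α)
      ≡⟨ cong (_+ ∑[ v < n ] (δ v q * d q ^ suc α)) (sym (∑-distrib-+ D (λ v → δ v p * d p ^ suc α))) ⟩
    ∑[ v < n ] (D v + δ v p * d p ^ suc α) + ∑[ v < n ] (δ v q * d q ^ suc α)
      ≡⟨ sym (∑-distrib-+ (λ v → D v + δ v p * d p ^ suc α) (λ v → δ v q * d q ^ suc α)) ⟩
    ∑[ v < n ] (D v + δ v p * d p ^ suc α + δ v q * d q ^ suc α)
      ≡⟨ sum-cong-≗ (orig-power α J) ⟩
    ∑[ v < n ] (d v ^ suc α + δ v q * (d q ∸ 1) ^ suc α)
      ≡⟨ ∑-distrib-+ (λ v → d v ^ suc α) (λ v → δ v q * (d q ∸ 1) ^ suc α) ⟩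
    moment (suc α) + ∑[ v < n ] (δ v q * (d q ∸ 1) ^ suc α)
      ≡⟨ cong (moment (suc α) +_) (∑-δ q (λ _ → (d q ∸ 1) ^ suc α)) ⟩
    moment (suc α) + (d q ∸ 1) ^ suc α ∎
    where
    D : Fin n → ℕ
    D v = deg (S∖ p k) (orig v) ^ suc α

  ∑-mid-power : ∀ α {k p q} → Joins k p q →
    ∑[ j < m ] (deg (S∖ p k) (mid j) ^ suc α) + 1 + 2 ^ suc α * d p ≡ m * 2 ^ suc α + d p
  ∑-mid-power α {k} {p} {q} J = begin
    ∑[ j < m ] W j + 1 + 2 ^ suc α * d p
      ≡⟨ cong₂ _+_ (cong (∑[ j < m ] W j +_) (sym (∑-δ-one k)))
                   (trans (cong (2 ^ suc α *_) (deg-≡-∑ p)) (*-distribˡ-sum (2 ^ suc α) c)) ⟩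
    ∑[ j < m ] W j + ∑[ j < m ] δ j k + ∑[ j < m ] (2 ^ suc α * c j)
      ≡⟨ cong (_+ ∑[ j < m ] (2 ^ suc α * c j)) (sym (∑-distrib-+ W (λ j → δ j k))) ⟩
    ∑[ j < m ] (W j + δ j k) + ∑[ j < m ] (2 ^ suc α * c j)
      ≡⟨ sym (∑-distrib-+ (λ j → W j + δ j k) (λ j → 2 ^ suc α * c j)) ⟩
    ∑[ j < m ] (W j + δ j k + 2 ^ suc α * c j)
      ≡⟨ sum-cong-≗ (mid-power α J) ⟩
    ∑[ j < m ] (2 ^ suc α + c j)
      ≡⟨ ∑-distrib-+ (λ _ → 2 ^ suc α) c ⟩
    ∑[ j < m ] (2 ^ suc α) + ∑[ j < m ] c j
      ≡⟨ cong₂ _+_ (∑-const m (2 ^ suc α)) (sym (deg-≡-∑ p)) ⟩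
    m * 2 ^ suc α + d p ∎
    where
    W c : Fin m → ℕ
    W j = deg (S∖ p k) (mid j) ^ suc α
    c j = δ (a j) p + δ (b j) p

  M1-S∖ : ∀ α {k p q} → Joins k p q →
    M1 (suc α) (S∖ p k) + (d p ^ suc α + d q ^ suc α) + (1 + 2 ^ suc α * d p)
      ≡ moment (suc α) + m * 2 ^ suc α + ((d q ∸ 1) ^ suc α + d p)
  M1-S∖ α {k} {p} {q} J = begin
    M1 (suc α) (S∖ p k) + (d p ^ suc α + d q ^ suc α) + (1 + 2 ^ suc α * d p)
      ≡⟨ cong (λ x → x + (d p ^ suc α + d q ^ suc α) + (1 + 2 ^ suc α * d p)) (M1-S∖-split α p k) ⟩
    Vs + Ws + (d p ^ suc α + d q ^ suc α) + (1 + 2 ^ suc α * d p)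
      ≡⟨ regroup Vs Ws (d p ^ suc α) (d q ^ suc α) (2 ^ suc α * d p) ⟩
    (Vs + d p ^ suc α + d q ^ suc α) + (Ws + 1 + 2 ^ suc α * d p)
      ≡⟨ cong₂ _+_ (∑-orig-power α J) (∑-mid-power α J) ⟩
    (moment (suc α) + (d q ∸ 1) ^ suc α) + (m * 2 ^ suc α + d p)
      ≡⟨ regroup′ (moment (suc α)) ((d q ∸ 1) ^ suc α) (m * 2 ^ suc α) (d p) ⟩
    moment (suc α) + m * 2 ^ suc α + ((d q ∸ 1) ^ suc α + d p) ∎
    where
    Vs Ws : ℕ
    Vs = ∑[ v < n ] (deg (S∖ p k) (orig v) ^ suc α)
    Ws = ∑[ j < m ] (deg (S∖ p k) (mid j) ^ suc α)
    regroup : ∀ V W x y z → V + W + (x + y) + (1 + z) ≡ (V + x + y) + (W + 1 + z)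
    regroup = solve-∀
    regroup′ : ∀ M h C e → (M + h) + (C + e) ≡ M + C + (h + e)
    regroup′ = solve-∀

  M1-S∖-both-ends : ∀ α k → let s = suc α ; C = moment s + m * 2 ^ s in
    M1 s (S∖ (a k) k) + M1 s (S∖ (b k) k)
      + ((2 * d (a k) ^ s + 1 + 2 ^ s * d (a k)) + (2 * d (b k) ^ s + 1 + 2 ^ s * d (b k)))
      ≡ 2 * C + (((d (a k) ∸ 1) ^ s + d (a k)) + ((d (b k) ∸ 1) ^ s + d (b k)))
  M1-S∖-both-ends α k = begin
    Tₐ + T_b + ((2 * xₐ + 1 + 2 ^ suc α * dₐ) + (2 * x_b + 1 + 2 ^ suc α * d_b))
      ≡⟨ regroup Tₐ T_b xₐ x_b (2 ^ suc α * dₐ) (2 ^ suc α * d_b) ⟩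
    (Tₐ + (xₐ + x_b) + (1 + 2 ^ suc α * dₐ)) + (T_b + (x_b + xₐ) + (1 + 2 ^ suc α * d_b))
      ≡⟨ cong₂ _+_ (M1-S∖ α (inj₁ (refl , refl))) (M1-S∖ α (inj₂ (refl , refl))) ⟩
    (C + ((d_b ∸ 1) ^ suc α + dₐ)) + (C + ((dₐ ∸ 1) ^ suc α + d_b))
      ≡⟨ regroup′ C ((dₐ ∸ 1) ^ suc α) ((d_b ∸ 1) ^ suc α) dₐ d_b ⟩
    2 * C + (((dₐ ∸ 1) ^ suc α + dₐ) + ((d_b ∸ 1) ^ suc α + d_b)) ∎
    where
    C Tₐ T_b dₐ d_b xₐ x_b : ℕ
    C = moment (suc α) + m * 2 ^ suc α
    Tₐ = M1 (suc α) (S∖ (a k) k)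
    T_b = M1 (suc α) (S∖ (b k) k)
    dₐ = d (a k)
    d_b = d (b k)
    xₐ = dₐ ^ suc α
    x_b = d_b ^ suc α
    regroup : ∀ Tₐ T_b x y u w →
      Tₐ + T_b + ((2 * x + 1 + u) + (2 * y + 1 + w)) ≡ (Tₐ + (x + y) + (1 + u)) + (T_b + (y + x) + (1 + w))
    regroup = solve-∀
    regroup′ : ∀ C hₐ h_b dₐ d_b → (C + (h_b + dₐ)) + (C + (hₐ + d_b)) ≡ 2 * C + ((hₐ + dₐ) + (h_b + d_b))
    regroup′ = solve-∀

  P2-M1-subdivision : ∀ α →
    P2 (M1 (suc α)) S + ∑[ v < n ] (d v * (2 * d v ^ suc α + 1 + 2 ^ suc α * d v))
      ≡ m * (2 * (moment (suc α) + m * 2 ^ suc α)) + ∑[ v < n ] (d v * ((d v ∸ 1) ^ suc α + d v))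
  P2-M1-subdivision α = begin
    P2 (M1 (suc α)) S + ∑[ v < n ] (d v * Φ v)
      ≡⟨ cong₂ _+_ (sum-map-edges-S (λ e → M1 (suc α) (delete S (proj₁ e) (proj₂ e)))) (sym (handshake Φ)) ⟩
    ∑[ k < m ] (T (a k) k + T (b k) k) + ∑[ k < m ] (Φ (a k) + Φ (b k))
      ≡⟨ sym (∑-distrib-+ (λ k → T (a k) k + T (b k) k) (λ k → Φ (a k) + Φ (b k))) ⟩
    ∑[ k < m ] (T (a k) k + T (b k) k + (Φ (a k) + Φ (b k)))
      ≡⟨ sum-cong-≗ (M1-S∖-both-ends α) ⟩
    ∑[ k < m ] (2 * C + (Ψ (a k) + Ψ (b k)))
      ≡⟨ ∑-distrib-+ (λ _ → 2 * C) (λ k → Ψ (a k) + Ψ (b k)) ⟩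
    ∑[ k < m ] (2 * C) + ∑[ k < m ] (Ψ (a k) + Ψ (b k))
      ≡⟨ cong₂ _+_ (∑-const m (2 * C)) (handshake Ψ) ⟩
    m * (2 * C) + ∑[ v < n ] (d v * Ψ v) ∎
    where
    C : ℕ
    C = moment (suc α) + m * 2 ^ suc α
    T : Fin n → Fin m → ℕ
    T p k = M1 (suc α) (S∖ p k)
    Φ Ψ : Fin n → ℕ
    Φ v = 2 * d v ^ suc α + 1 + 2 ^ suc α * d v
    Ψ v = (d v ∸ 1) ^ suc α + d v

  ∑-deg≡2m : ∑[ v < n ] d v ≡ 2 * m
  ∑-deg≡2m = begin
    ∑[ v < n ] d v               ≡⟨ sum-cong-≗ (λ v → sym (*-identityʳ (d v))) ⟩
    ∑[ v < n ] (d v * 1)         ≡⟨ sym (handshake (λ _ → 1)) ⟩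
    ∑[ k < m ] 2                 ≡⟨ ∑-const m 2 ⟩
    m * 2                        ≡⟨ *-comm m 2 ⟩
    2 * m                        ∎

  moment≡M1 : ∀ α → moment α ≡ M1 α (toGraph G)
  moment≡M1 α = sym (sum-map-tabulate (λ v → d v ^ α) (λ v → v))

  ∑-binomial-identity :
    ∑[ v < n ] (d v * ((d v ∸ 1) ^ 5 + d v)) + ∑[ v < n ] (d v ^ 6 + 2 * d v + 5 * d v ^ 5 + 10 * d v ^ 3 + 26 * d v ^ 2)
      ≡ ∑[ v < n ] (d v * (2 * d v ^ 5 + 1 + 32 * d v)) + 10 * moment 4
  ∑-binomial-identity = begin
    ∑[ v < n ] (d v * ((d v ∸ 1) ^ 5 + d v)) + ∑[ v < n ] (d v ^ 6 + 2 * d v + 5 * d v ^ 5 + 10 * d v ^ 3 + 26 * d v ^ 2)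
      ≡⟨ sym (∑-distrib-+ (λ v → d v * ((d v ∸ 1) ^ 5 + d v))
                          (λ v → d v ^ 6 + 2 * d v + 5 * d v ^ 5 + 10 * d v ^ 3 + 26 * d v ^ 2)) ⟩
    ∑[ v < n ] (d v * ((d v ∸ 1) ^ 5 + d v) + (d v ^ 6 + 2 * d v + 5 * d v ^ 5 + 10 * d v ^ 3 + 26 * d v ^ 2))
      ≡⟨ sum-cong-≗ (λ v → binomial-identity (d v)) ⟩
    ∑[ v < n ] (d v * (2 * d v ^ 5 + 1 + 32 * d v) + 10 * d v ^ 4)
      ≡⟨ ∑-linear 10 (λ v → d v * (2 * d v ^ 5 + 1 + 32 * d v)) (λ v → d v ^ 4) ⟩
    ∑[ v < n ] (d v * (2 * d v ^ 5 + 1 + 32 * d v)) + 10 * moment 4 ∎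

  ∑-into-moments :
    ∑[ v < n ] (d v ^ 6 + 2 * d v + 5 * d v ^ 5 + 10 * d v ^ 3 + 26 * d v ^ 2)
      ≡ moment 6 + 4 * m + 5 * moment 5 + 10 * moment 3 + 26 * moment 2
  ∑-into-moments = begin
    ∑[ v < n ] (d v ^ 6 + 2 * d v + 5 * d v ^ 5 + 10 * d v ^ 3 + 26 * d v ^ 2)
      ≡⟨ ∑-linear 26 _ (λ v → d v ^ 2) ⟩
    ∑[ v < n ] (d v ^ 6 + 2 * d v + 5 * d v ^ 5 + 10 * d v ^ 3) + 26 * moment 2
      ≡⟨ cong (_+ 26 * moment 2) (∑-linear 10 _ (λ v → d v ^ 3)) ⟩
    ∑[ v < n ] (d v ^ 6 + 2 * d v + 5 * d v ^ 5) + 10 * moment 3 + 26 * moment 2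
      ≡⟨ cong (λ s → s + 10 * moment 3 + 26 * moment 2) (∑-linear 5 _ (λ v → d v ^ 5)) ⟩
    ∑[ v < n ] (d v ^ 6 + 2 * d v) + 5 * moment 5 + 10 * moment 3 + 26 * moment 2
      ≡⟨ cong (λ s → s + 5 * moment 5 + 10 * moment 3 + 26 * moment 2) (∑-linear 2 (λ v → d v ^ 6) d) ⟩
    moment 6 + 2 * ∑[ v < n ] d v + 5 * moment 5 + 10 * moment 3 + 26 * moment 2
      ≡⟨ cong (λ s → moment 6 + s + 5 * moment 5 + 10 * moment 3 + 26 * moment 2)
              (trans (cong (2 *_) ∑-deg≡2m) (sym (*-assoc 2 2 m))) ⟩
    moment 6 + 4 * m + 5 * moment 5 + 10 * moment 3 + 26 * moment 2 ∎

  P2-M1⁵-subdivision : let M = λ α → M1 α (toGraph G) in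
    P2 (M1 5) S + (M 6 + 4 * m + 5 * M 5 + 10 * M 3 + 26 * M 2) ≡ 2 * m * M 5 + 64 * (m * m) + 10 * M 4
  P2-M1⁵-subdivision
    rewrite sym (moment≡M1 2) | sym (moment≡M1 3) | sym (moment≡M1 4) | sym (moment≡M1 5) | sym (moment≡M1 6) = begin
    P2 (M1 5) S + (moment 6 + 4 * m + 5 * moment 5 + 10 * moment 3 + 26 * moment 2)
      ≡⟨ cong (P2 (M1 5) S +_) (sym ∑-into-moments) ⟩
    P2 (M1 5) S + L
      ≡⟨ +-cancelʳ-≡ A _ _ cancel-A ⟩
    B + 10 * moment 4
      ≡⟨ expand-B m (moment 5) (moment 4) ⟩
    2 * m * moment 5 + 64 * (m * m) + 10 * moment 4 ∎
    where
    A X L B : ℕ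
    A = ∑[ v < n ] (d v * (2 * d v ^ 5 + 1 + 32 * d v))
    X = ∑[ v < n ] (d v * ((d v ∸ 1) ^ 5 + d v))
    L = ∑[ v < n ] (d v ^ 6 + 2 * d v + 5 * d v ^ 5 + 10 * d v ^ 3 + 26 * d v ^ 2)
    B = m * (2 * (moment 5 + m * 32))
    cancel-A : P2 (M1 5) S + L + A ≡ B + 10 * moment 4 + A
    cancel-A = begin
      P2 (M1 5) S + L + A        ≡⟨ swap-last (P2 (M1 5) S) L A ⟩
      P2 (M1 5) S + A + L        ≡⟨ cong (_+ L) (P2-M1-subdivision 4) ⟩
      B + X + L                  ≡⟨ +-assoc B X L ⟩
      B + (X + L)                ≡⟨ cong (B +_) ∑-binomial-identity ⟩
      B + (A + 10 * moment 4)    ≡⟨ regroup B A (10 * moment 4) ⟩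
      B + 10 * moment 4 + A      ∎
      where
      swap-last : ∀ x y z → x + y + z ≡ x + z + y
      swap-last = solve-∀
      regroup : ∀ x y z → x + (y + z) ≡ x + z + y
      regroup = solve-∀
    expand-B : ∀ m M₅ M₄ → m * (2 * (M₅ + m * 32)) + 10 * M₄ ≡ 2 * m * M₅ + 64 * (m * m) + 10 * M₄
    expand-B = solve-∀

open Subdivision using (P2-M1⁵-subdivision)

open import Data.Integer using (+_; _+_; _-_; _*_)
open import Data.Integer.Properties using (pos-*)
open import Data.Integer.Tactic.RingSolver using (solve-∀)
import Data.Nat as ℕ

ℕ-identity⇒ℤ : ∀ (P m M₂ M₃ M₄ M₅ M₆ : ℕ) →
  P ℕ.+ (M₆ ℕ.+ 4 ℕ.* m ℕ.+ 5 ℕ.* M₅ ℕ.+ 10 ℕ.* M₃ ℕ.+ 26 ℕ.* M₂)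
    ≡ 2 ℕ.* m ℕ.* M₅ ℕ.+ 64 ℕ.* (m ℕ.* m) ℕ.+ 10 ℕ.* M₄ →
  + P ≡ + 2 * + m * + M₅ + + 64 * (+ m * + m) - + M₆ - + 4 * + m - + 5 * + M₅ + + 10 * + M₄ - + 10 * + M₃ - + 26 * + M₂
ℕ-identity⇒ℤ P m M₂ M₃ M₄ M₅ M₆ identity = begin
  + P                                    ≡⟨ add-sub (+ P) (+ subtrahend) ⟩
  + (P ℕ.+ subtrahend) - + subtrahend    ≡⟨ cong (λ x → + x - + subtrahend) identity ⟩
  + total - + subtrahend                 ≡⟨ cong₂ _-_ cast-total cast-subtrahend ⟩
  (+ 2 * + m * + M₅ + + 64 * (+ m * + m) + + 10 * + M₄)
    - (+ M₆ + + 4 * + m + + 5 * + M₅ + + 10 * + M₃ + + 26 * + M₂)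
                                         ≡⟨ distribute-minus (+ m) (+ M₂) (+ M₃) (+ M₄) (+ M₅) (+ M₆) ⟩
  + 2 * + m * + M₅ + + 64 * (+ m * + m) - + M₆ - + 4 * + m - + 5 * + M₅ + + 10 * + M₄ - + 10 * + M₃ - + 26 * + M₂ ∎
  where
  open ≡-Reasoning
  subtrahend total : ℕ
  subtrahend = M₆ ℕ.+ 4 ℕ.* m ℕ.+ 5 ℕ.* M₅ ℕ.+ 10 ℕ.* M₃ ℕ.+ 26 ℕ.* M₂
  total = 2 ℕ.* m ℕ.* M₅ ℕ.+ 64 ℕ.* (m ℕ.* m) ℕ.+ 10 ℕ.* M₄
  cast-subtrahend : + subtrahend ≡ + M₆ + + 4 * + m + + 5 * + M₅ + + 10 * + M₃ + + 26 * + M₂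
  cast-subtrahend =
    cong₂ _+_ (cong₂ _+_ (cong₂ _+_ (cong (_+_ (+ M₆)) (pos-* 4 m)) (pos-* 5 M₅)) (pos-* 10 M₃)) (pos-* 26 M₂)
  cast-total : + total ≡ + 2 * + m * + M₅ + + 64 * (+ m * + m) + + 10 * + M₄
  cast-total = cong₂ _+_ (cong₂ _+_ (trans (pos-* (2 ℕ.* m) M₅) (cong (_* + M₅) (pos-* 2 m)))
                                    (trans (pos-* 64 (m ℕ.* m)) (cong (+ 64 *_) (pos-* m m))))
                         (pos-* 10 M₄)
  add-sub : ∀ x y → x ≡ x + y - y
  add-sub = solve-∀
  distribute-minus : ∀ m M₂ M₃ M₄ M₅ M₆ →
    (+ 2 * m * M₅ + + 64 * (m * m) + + 10 * M₄) - (M₆ + + 4 * m + + 5 * M₅ + + 10 * M₃ + + 26 * M₂)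
      ≡ + 2 * m * M₅ + + 64 * (m * m) - M₆ - + 4 * m - + 5 * M₅ + + 10 * M₄ - + 10 * M₃ - + 26 * M₂
  distribute-minus = solve-∀

lemma2p4 : (n : ℕ) (G : SimpleGraph n) →
    let m = numEdges G
        M = λ (k : ℕ) → + M1 k (toGraph G)
    in + P2 (M1 5) (subdivision G)
         ≡ + 2 * + m * M 5 + + 64 * (+ m * + m) - M 6 - + 4 * + m - + 5 * M 5
           + + 10 * M 4 - + 10 * M 3 - + 26 * M 2
lemma2p4 n G = ℕ-identity⇒ℤ (P2 (M1 5) (subdivision G)) (numEdges G) (M 2) (M 3) (M 4) (M 5) (M 6) (P2-M1⁵-subdivision G)
  where
  M : ℕ → ℕ
  M k = M1 k (toGraph G)
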